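{- Let $I\subseteq[n]$, $\overline J\subseteq[\overline n]$ be a valid pair and $G=G(I,\overline J)$. The triangulation $\mathscr T_{len}$ of $\mathcal F_{\widehat G}$ obtained by reducing the monomial $M_G$ in the length reduction order is a geometric realization of the $(I,\overline J)$-Tamari complex $\mathscr C_{I,\overline J}$; that is, assigning to the vertex $\chi(R)$ of $\mathcal F_{\widehat G}$, where the route $R$ begins with the edge $(s,i)$ and ends with the edge $(\mathrm{prec}(\overline j),t)$, the arc $(i,\overline j)$, is a bijection from the vertices of $\mathcal F_{\widehat G}$ to the arcs of $A(I,\overline J)$ under which the vertex sets of the simplices of $\mathscr T_{len}$ correspond exactly to the faces of $\mathscr C_{I,\overline J}$.
   Context: Fix $n\ge1$, $[n]=\{1,\dots,n\}$, $[\overline n]=\{\overline1,\dots,\overline n\}$, ordered by $1\prec\overline1\prec2\prec\cdots\prec n\prec\overline n$. A pair $I\subseteq[n]$, $\overline J\subseteq[\overline n]$ is valid if $\min(I\sqcup\overline J)\in I$, $\max(I\sqcup\overline J)\in\overline J$. Define $\mathrm{prec}:\overline J\to[n]$: if in $\prec$ restricted to $I\sqcup\overline J$ the element $\overline j$ is immediately preceded by some $i\in I$, then $\mathrm{prec}(\overline j)=i$, otherwise $\mathrm{prec}(\overline j)=j$. $A(I,\overline J)$ is the graph on $I\sqcup\overline J$ with arcs $(i,\overline j)$, $i\in I$, $\overline j\in\overline J$, $i\prec\overline j$. Let $\mathrm{prec}(A(I,\overline J))$ be the simple directed graph on $I\cup\mathrm{prec}(\overline J)\subseteq[n]$ with edges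 $(i,\mathrm{prec}(\overline j))$ for $i\in I$, $\overline j\in\overline J$, $i<\mathrm{prec}(\overline j)$; $\min(H)$ deletes each edge $(i,j)$ of $H$ for which $H$ has a directed path from $i$ to $j$ with at least two edges; $G(I,\overline J)=\min(\mathrm{prec}(A(I,\overline J)))$. $\widehat G$ has vertex set $V(G)\cup\{s,t\}$ and edges $E(G)\cup\{(s,i):i\in I\}\cup\{(\mathrm{prec}(\overline j),t):\overline j\in\overline J\}$; routes are directed $s$–$t$ paths, $\chi(R)\in\mathbb R^{E(\widehat G)}$ the indicator vector; $\mathcal F_{\widehat G}=\mathrm{conv}\{\chi(R)\}$ is the unit $s$–$t$ flow polytope of $\widehat G$. Subdivision algebra: polynomials in commuting $\beta$, $x_{ab}$ ($a<b$); $M_G=\prod_{(a,b)\in E(G)}x_{ab}$; a reduction at $x_{ij},x_{jk}$ ($i<j<k$) replaces, in a monomial divisible by $x_{ij}x_{jk}$, this factor by $x_{ik}x_{ij}+x_{jk}x_{ik}+\beta x_{ik}$; a reduced form is obtained by reducing from $M_G$ until no monomial is divisible by any $x_{ij}x_{jk}$, $i<j<k$. The graph of a monomial has an edge $(a,b)$ per factor $x_{ab}$. A pair $(i,j),(j,k)$ with $i<j<k$ is a longest pair at $j$ if there is no edge $(i',j)$ with $i'<i$ and no edge $(j,k')$ with $k'>k$. The length reduction order: each reduction of a monomial is at a longest pair at $j$, where $j$ is the minimal vertex that is the middle vertex of some pair $(i,j),(j,k)$ with $i<j<k$ in the monomial's graph. For a factor $x_{ab}$ of a monomial of a reduced form,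 $R_{ab}$ is the route $(s,a)$, the unique directed path in $G$ from $a$ to $b$, $(b,t)$. If $p$ is the reduced form obtained in the length reduction order, $\mathscr T_{len}$ is the triangulation of $\mathcal F_{\widehat G}$ whose maximal simplices are $\Delta_M=\mathrm{conv}(\{\chi(R_{ab}):x_{ab}\mid M\}\cup\{\chi(s,v,t):v\in I\cap\mathrm{prec}(\overline J)\})$ for the monomials $M$ of $p$ not divisible by $\beta$. Two arcs $(i,\overline j),(i',\overline j')$ of $A(I,\overline J)$ cross if $i\prec i'\prec\overline j\prec\overline j'$. An $(I,\overline J)$-forest is a subgraph of $A(I,\overline J)$ with no two crossing arcs. The $(I,\overline J)$-Tamari complex $\mathscr C_{I,\overline J}$ is the flag simplicial complex whose vertices are the arcs of $A(I,\overline J)$ and whose faces are the arc sets of $(I,\overline J)$-forests (minimal non-faces: pairs of crossing arcs). -}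

module Defs where

open import Data.Nat using (ℕ; zero; suc)
open import Data.Fin using (Fin; _<_; _≤_)
open import Data.Fin.Subset using (Subset; _∈_)
open import Data.List using (List; []; _∷_; _++_)
open import Data.List.Membership.Propositional using () renaming (_∈_ to _∈L_)
open import Data.List.Relation.Binary.Permutation.Propositional using (_↭_)
open import Data.List.Relation.Binary.Pointwise using (Pointwise)
open import Data.List.Relation.Unary.All using (All)
open import Data.Product using (Σ; ∃; ∃!; _×_; _,_)
open import Data.Sum using (_⊎_)
open import Relation.Nullary using (¬_)
open import Relation.Binary.PropositionalEquality using (_≡_)
open import Relation.Binary.Construct.Closure.Transitive using (TransClosure)

-- Conventions: [n] is encoded by Fin n (0-based, same order).  The element
-- j̄ of [n̄] is encoded by j : Fin n.  I, J : Subset n, where J encodes J̄.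
-- In the order ≺ :  i ≺ i' iff i < i',  i ≺ j̄ iff i ≤ j,
--                   j̄ ≺ i iff j < i,    j̄ ≺ j̄' iff j < j'.

module _ {n : ℕ} (I J : Subset n) where

  -- valid pair: min(I ⊔ J̄) ∈ I and max(I ⊔ J̄) ∈ J̄
  Valid : Set
  Valid = (∃ λ i → i ∈ I × (∀ j → j ∈ J → i ≤ j))
        × (∃ λ j → j ∈ J × (∀ i → i ∈ I → i ≤ j))

  Between : Fin n → Fin n → Set
  Between i j = (∃ λ x → x ∈ I × i < x × x ≤ j)
              ⊎ (∃ λ x → x ∈ J × i ≤ x × x < j)

  ImmPred : Fin n → Fin n → Set
  ImmPred i j = i ∈ I × i ≤ j × ¬ Between i j

  IsPrec : Fin n → Fin n → Set
  IsPrec j v = ImmPred v j ⊎ ((∀ i → ¬ ImmPred i j) × v ≡ j)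

  InPrecJ : Fin n → Set
  InPrecJ v = ∃ λ j → j ∈ J × IsPrec j v

  Arc : Fin n × Fin n → Set
  Arc (i , j) = i ∈ I × j ∈ J × i ≤ j

  PrecEdge : Fin n → Fin n → Set
  PrecEdge a b = ∃ λ j → Arc (a , j) × IsPrec j b × a < b

  GEdge : Fin n → Fin n → Set
  GEdge a b = PrecEdge a b
            × ¬ (∃ λ c → PrecEdge a c × TransClosure PrecEdge c b)

data IsPath {A : Set} (R : A → A → Set) : List A → A → A → Set where
  single : ∀ {a} → IsPath R (a ∷ []) a a
  cons   : ∀ {a b c vs} → R a b → IsPath R (b ∷ vs) b c → IsPath R (a ∷ b ∷ vs) a c

module _ {n : ℕ} (I J : Subset n) where

  -- routes of Ĝ : s → i → (path in G) → v → t, with i ∈ I, v ∈ prec(J̄);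
  -- a route is recorded by its list of vertices in G
  IsRoute : List (Fin n) → Set
  IsRoute vs = ∃ λ a → ∃ λ b → IsPath (GEdge I J) vs a b × a ∈ I × InPrecJ I J b

  -- the route vs begins with (s,i) and ends with (prec(j̄),t)
  Corr : List (Fin n) → Fin n × Fin n → Set
  Corr vs (i , j) = ∃ λ b → IsPath (GEdge I J) vs i b × IsPrec I J j b

  Cross : Fin n × Fin n → Fin n × Fin n → Set
  Cross (i , j) (i' , j') = i < i' × i' ≤ j × j < j'

  Forest : List (Fin n × Fin n) → Set
  Forest As = ∀ a b → a ∈L As → b ∈L As → ¬ Cross a b

-- Subdivision algebra: a monomial β^d ∏ x_ab (factors as a list, i.e. a
-- multiset of edges (a , b) with a < b).  A polynomial with nonnegative
-- coefficients is recorded as the list of its monomial terms.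

record Mono (n : ℕ) : Set where
  constructor mono
  field
    βdeg    : ℕ
    factors : List (Fin n × Fin n)
open Mono public

module _ {n : ℕ} where

  HasPair : Mono n → Fin n → Fin n → Fin n → Set
  HasPair m i j k = (i , j) ∈L factors m × (j , k) ∈L factors m × i < j × j < k

  IsReduced : Mono n → Set
  IsReduced m = ∀ i j k → ¬ HasPair m i j k

  -- the pair chosen by the length reduction order: a longest pair at j,
  -- with j the minimal middle vertex of a pair
  LengthPair : Mono n → Fin n → Fin n → Fin n → Set
  LengthPair m i j k =
      HasPair m i j k
    × (∀ i' j' k' → HasPair m i' j' k' → j ≤ j')
    × (∀ i' → (i' , j) ∈L factors m → i ≤ i')
    × (∀ k' → (j , k') ∈L factors m → k' ≤ k)

  data Reduces : Mono n → List (Mono n) → Set where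
    done : ∀ {m} → IsReduced m → Reduces m (m ∷ [])
    step : ∀ {m i j k rest p₁ p₂ p₃} →
           LengthPair m i j k →
           factors m ↭ ((i , j) ∷ (j , k) ∷ rest) →
           Reduces (mono (βdeg m) ((i , k) ∷ (i , j) ∷ rest)) p₁ →
           Reduces (mono (βdeg m) ((j , k) ∷ (i , k) ∷ rest)) p₂ →
           Reduces (mono (suc (βdeg m)) ((i , k) ∷ rest)) p₃ →
           Reduces m (p₁ ++ p₂ ++ p₃)

module _ {n : ℕ} (I J : Subset n) where

  -- vs is a vertex of the simplex Δ_M : vs = R_ab for a factor x_ab of M,
  -- or vs = (s, v, t) with v ∈ I ∩ prec(J̄)
  InΔ : Mono n → List (Fin n) → Set
  InΔ M vs = (∃ λ a → ∃ λ b → (a , b) ∈L factors M × IsPath (GEdge I J) vs a b)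
           ⊎ (∃ λ v → vs ≡ v ∷ [] × v ∈ I × InPrecJ I J v)

  RouteArcBijection : Set
  RouteArcBijection =
      (∀ vs → IsRoute I J vs → ∃! _≡_ (λ a → Arc I J a × Corr I J vs a))
    × (∀ a → Arc I J a → ∃! _≡_ (λ vs → IsRoute I J vs × Corr I J vs a))

  FacesCorrespond : List (Mono n) → Set
  FacesCorrespond p =
    ∀ (Rs : List (List (Fin n))) (As : List (Fin n × Fin n)) →
      All (IsRoute I J) Rs → All (Arc I J) As → Pointwise (Corr I J) Rs As →
      ((∃ λ M → M ∈L p × βdeg M ≡ 0 × All (InΔ M) Rs) → Forest I J As)
    × (Forest I J As → ∃ λ M → M ∈L p × βdeg M ≡ 0 × All (InΔ M) Rs)

-- Call an edge list admissible if its edges (a, b) satisfy a < b, occur once, and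
-- (i) when a vertex has out-neighbours x < y, everything reachable from x lies below everything
-- reachable from y, and (ii) two paths whose endpoint pairs cross share a vertex.  G(I, J̄) is
-- admissible because its edges are the pairs a < b in I × prec(J̄) with no element of
-- I ∩ prec(J̄) strictly between.  By (i), a route of Ĝ is determined by its endpoints (i, prec j̄),
-- and prec is strictly increasing on J̄, which gives the bijection and turns crossing arcs into
-- crossing endpoint pairs.  A reduction at a longest pair (i, j), (j, k) with j minimal keeps
-- both β-free terms admissible.  In a reduced monomial paths have at most one edge, so by (ii)
-- two crossing routes would produce a reducible pair: β-free leaves span forests.  Conversely,
-- the paths lost in the first β-free term run through jk without coming from i, those lost in
-- the second start with ij and do not go on to k, and one of each would cross; so a forest
-- survives in one of the two terms all the way down to a leaf.

module Submission where

open import Defs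
open import Data.Nat as ℕ using (ℕ)
import Data.Nat.Properties as ℕ
open import Data.Nat.Induction using (<-wellFounded)
open import Data.Nat.ListAction using (sum)
open import Data.Nat.ListAction.Properties using (sum-↭)
open import Data.Fin as Fin using (Fin; toℕ)
open import Data.Fin.Properties
  using (_≟_; _<?_; _≤?_; <-cmp; <-irrefl; <⇒≢; ≤∧≢⇒<; ≤-antisym; any?; all?; toℕ≤n)
import Data.Fin.Induction as Fin
open import Data.Fin.Subset using (Subset) renaming (_∈_ to _∈S_)
open import Data.Fin.Subset.Properties using () renaming (_∈?_ to _∈S?_)
open import Data.List using (List; []; _∷_; _++_; map)
open import Data.List.Membership.Propositional using () renaming (_∈_ to _∈L_)
open import Data.List.Membership.Propositional.Properties using (∈-++⁻; ∈-++⁺ˡ; ∈-++⁺ʳ; ∈-∃++)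
import Data.List.Membership.DecPropositional as DecMembership
open import Data.List.Relation.Unary.Any using (here; there)
open import Data.List.Relation.Unary.All as All using (All; []; _∷_)
open import Data.List.Relation.Unary.AllPairs using (_∷_)
open import Data.List.Relation.Unary.All.Properties using (¬Any⇒All¬)
open import Data.List.Relation.Unary.Unique.Propositional using (Unique)
open import Data.List.Relation.Binary.Pointwise using (Pointwise; []; _∷_)
open import Data.List.Relation.Binary.Permutation.Propositional
  using (_↭_; ↭-refl; ↭-sym; ↭-trans; prep; swap; ↭⇒↭ₛ)
open import Data.List.Relation.Binary.Permutation.Propositional.Properties using (∈-resp-↭; shift; map⁺)
import Data.List.Relation.Binary.Permutation.Setoid.Properties as PermutationSetoid
open import Data.Product using (∃; ∃!; _×_; _,_; proj₁; proj₂)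
open import Data.Product.Properties using (≡-dec)
open import Data.Sum using (_⊎_; inj₁; inj₂; map₂)
open import Data.Empty using (⊥; ⊥-elim)
open import Function using (_∘_)
open import Induction.WellFounded using (Acc; acc)
open import Level using (0ℓ)
open import Relation.Nullary using (¬_; Dec; yes; no)
open import Relation.Nullary.Decidable using (_×-dec_; _⊎-dec_; ¬?)
open import Relation.Unary using (Pred; Decidable)
open import Relation.Binary using (tri<; tri≈; tri>)
open import Relation.Binary.PropositionalEquality using (_≡_; _≢_; refl; sym; trans; cong; subst; setoid)
open import Relation.Binary.Construct.Closure.ReflexiveTransitive as Star using (Star; ε; _◅_; _◅◅_; _⋆)
open import Relation.Binary.Construct.Closure.Transitive using (TransClosure; [_]; _∷_)

all-or-witness : ∀ {A : Set} {P Q R : A → Set} {xs} → (∀ {x} → P x → Q x ⊎ R x) →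
                 All P xs → All Q xs ⊎ ∃ λ x → x ∈L xs × R x
all-or-witness decide []         = inj₁ []
all-or-witness decide (px ∷ pxs) with decide px | all-or-witness decide pxs
... | inj₂ rx | _                     = inj₂ (_ , here refl , rx)
... | inj₁ qx | inj₁ qxs              = inj₁ (qx ∷ qxs)
... | inj₁ _  | inj₂ (y , y∈xs , ry)  = inj₂ (y , there y∈xs , ry)

pointwise-∈ˡ : ∀ {A B : Set} {R : A → B → Set} {xs ys x} → Pointwise R xs ys → x ∈L xs →
               ∃ λ y → y ∈L ys × R x y
pointwise-∈ˡ (r ∷ _)  (here refl) = _ , here refl , r
pointwise-∈ˡ (_ ∷ rs) (there x∈)  = let (y , y∈ , r) = pointwise-∈ˡ rs x∈ in y , there y∈ , r

pointwise-∈ʳ : ∀ {A B : Set} {R : A → B → Set} {xs ys y} → Pointwise R xs ys → y ∈L ys →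
               ∃ λ x → x ∈L xs × R x y
pointwise-∈ʳ (r ∷ _)  (here refl) = _ , here refl , r
pointwise-∈ʳ (_ ∷ rs) (there y∈)  = let (x , x∈ , r) = pointwise-∈ʳ rs y∈ in x , there x∈ , r

module _ {n : ℕ} where

  least : {P : Pred (Fin n) 0ℓ} → Decidable P → ∃ P → ∃ λ x → P x × ∀ z → P z → x Fin.≤ z
  least {P} P? (x , px) = go x px (Fin.<-wellFounded x)
    where
    go : ∀ x → P x → Acc Fin._<_ x → ∃ λ y → P y × ∀ z → P z → y Fin.≤ z
    go x px (acc below) with any? (λ z → P? z ×-dec z <? x)
    ... | yes (z , pz , z<x) = go z pz (below z<x)
    ... | no none = x , px , λ z pz → ℕ.≮⇒≥ (λ z<x → none (z , pz , z<x))

  greatest : {P : Pred (Fin n) 0ℓ} → Decidable P → ∃ P → ∃ λ x → P x × ∀ z → P z → z Fin.≤ x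
  greatest {P} P? (x , px) = go x px (Fin.>-wellFounded x)
    where
    go : ∀ x → P x → Acc Fin._>_ x → ∃ λ y → P y × ∀ z → P z → z Fin.≤ y
    go x px (acc above) with any? (λ z → P? z ×-dec x <? z)
    ... | yes (z , pz , x<z) = go z pz (above x<z)
    ... | no none = x , px , λ z pz → ℕ.≮⇒≥ (λ x<z → none (z , pz , x<z))

  _≟ₚ_ : (s t : Fin n × Fin n) → Dec (s ≡ t)
  _≟ₚ_ = ≡-dec _≟_ _≟_

  Crossing : Fin n × Fin n → Fin n × Fin n → Set
  Crossing (a , b) (a' , b') = a Fin.< a' × a' Fin.≤ b × b Fin.< b'

  NonCrossing : List (Fin n × Fin n) → Set
  NonCrossing S = ∀ {s t} → s ∈L S → t ∈L S → ¬ Crossing s t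

  Connects : (Fin n → Fin n → Set) → Fin n × Fin n → Set
  Connects E s = Star E (proj₁ s) (proj₂ s)

module _ {n : ℕ} (E : Fin n → Fin n → Set) where

  Increasing : Set
  Increasing = ∀ {x y} → E x y → x Fin.< y

  BranchesOrdered : Set
  BranchesOrdered = ∀ {v x y p q} → E v x → E v y → x Fin.< y → Star E x p → Star E y q → p Fin.< q

  CrossingPathsMeet : Set
  CrossingPathsMeet = ∀ {a b a' b'} → Star E a b → Star E a' b' → Crossing (a , b) (a' , b') →
                      ∃ λ w → Star E a w × Star E w b × Star E a' w × Star E w b'

module _ {n : ℕ} {E : Fin n → Fin n → Set} where

  star-≤ : Increasing E → ∀ {x y} → Star E x y → x Fin.≤ y
  star-≤ inc ε       = ℕ.≤-refl
  star-≤ inc (e ◅ r) = ℕ.<⇒≤ (ℕ.<-≤-trans (inc e) (star-≤ inc r))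

  star-trivial-or-snoc : ∀ {a w} → Star E a w → a ≡ w ⊎ ∃ λ u → Star E a u × E u w
  star-trivial-or-snoc ε = inj₁ refl
  star-trivial-or-snoc (e ◅ r) with star-trivial-or-snoc r
  ... | inj₁ refl           = inj₂ (_ , ε , e)
  ... | inj₂ (u , r' , e')  = inj₂ (u , e ◅ r' , e')

  branches-meet⇒≡ : BranchesOrdered E → ∀ {v x y b} → E v x → E v y → Star E x b → Star E y b → x ≡ y
  branches-meet⇒≡ ordered {x = x} {y} e e' r r' with <-cmp x y
  ... | tri< x<y _ _ = ⊥-elim (<-irrefl refl (ordered e e' x<y r r'))
  ... | tri≈ _ x≡y _ = x≡y
  ... | tri> _ _ y<x = ⊥-elim (<-irrefl refl (ordered e' e y<x r' r))

  path⇒star : ∀ {vs a b} → IsPath E vs a b → Star E a b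
  path⇒star single     = ε
  path⇒star (cons e p) = e ◅ path⇒star p

  star⇒path : ∀ {a b} → Star E a b → ∃ λ vs → IsPath E vs a b
  star⇒path ε = _ , single
  star⇒path (e ◅ r) with star⇒path r
  ... | _ , single    = _ , cons e single
  ... | _ , cons e' p = _ , cons e (cons e' p)

  path-endpoints : ∀ {vs a b a' b'} → IsPath E vs a b → IsPath E vs a' b' → a ≡ a' × b ≡ b'
  path-endpoints single     single       = refl , refl
  path-endpoints (cons _ p) (cons _ p') = refl , proj₂ (path-endpoints p p')

  path-unique : Increasing E → BranchesOrdered E → ∀ {vs vs' a b} →
                IsPath E vs a b → IsPath E vs' a b → vs ≡ vs'
  path-unique inc ordered single     single       = refl
  path-unique inc ordered single     (cons e p)   = ⊥-elim (ℕ.<⇒≱ (inc e) (star-≤ inc (path⇒star p)))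
  path-unique inc ordered (cons e p) single       = ⊥-elim (ℕ.<⇒≱ (inc e) (star-≤ inc (path⇒star p)))
  path-unique inc ordered (cons {a = a} e p) (cons e' p')
    with branches-meet⇒≡ ordered e e' (path⇒star p) (path⇒star p')
  ... | refl = cong (a ∷_) (path-unique inc ordered p p')

  path-trivial : Increasing E → ∀ {vs a} → IsPath E vs a a → vs ≡ a ∷ []
  path-trivial inc single     = refl
  path-trivial inc (cons e p) = ⊥-elim (ℕ.<⇒≱ (inc e) (star-≤ inc (path⇒star p)))

-- Admissible edge lists and the length reduction step

module _ {n : ℕ} where

  Edges : List (Fin n × Fin n) → Fin n → Fin n → Set
  Edges F x y = (x , y) ∈L F

  record Admissible (F : List (Fin n × Fin n)) : Set where
    field
      unique            : Unique F
      increasing        : Increasing (Edges F)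
      branchesOrdered   : BranchesOrdered (Edges F)
      crossingPathsMeet : CrossingPathsMeet (Edges F)

  open PermutationSetoid (setoid (Fin n × Fin n)) using (Unique-resp-↭)

  admissible-resp-↭ : ∀ {F F'} → F ↭ F' → Admissible F → Admissible F'
  admissible-resp-↭ {F} {F'} σ adm = record
    { unique            = Unique-resp-↭ (↭⇒↭ₛ σ) unique
    ; increasing        = increasing ∘ back
    ; branchesOrdered   = λ e e' x<y r r' →
        branchesOrdered (back e) (back e') x<y (Star.map back r) (Star.map back r')
    ; crossingPathsMeet = λ r r' cross →
        let (w , aw , wb , a'w , wb') = crossingPathsMeet (Star.map back r) (Star.map back r') cross
        in w , Star.map forth aw , Star.map forth wb , Star.map forth a'w , Star.map forth wb'
    }
    where
    open Admissible adm
    back : ∀ {x y} → Edges F' x y → Edges F x y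
    back = ∈-resp-↭ (↭-sym σ)
    forth : ∀ {x y} → Edges F x y → Edges F' x y
    forth = ∈-resp-↭ σ

module LengthStep {n : ℕ} {m : Mono n} {i j k : Fin n} {rest : List (Fin n × Fin n)}
  (adm : Admissible (factors m)) (lp : LengthPair m i j k)
  (σ : factors m ↭ (i , j) ∷ (j , k) ∷ rest) where

  F H₁ H₂ : List (Fin n × Fin n)
  F  = (i , j) ∷ (j , k) ∷ rest
  H₁ = (i , k) ∷ (i , j) ∷ rest
  H₂ = (j , k) ∷ (i , k) ∷ rest

  E E₁ E₂ : Fin n → Fin n → Set
  E  = Edges F
  E₁ = Edges H₁
  E₂ = Edges H₂

  to-F : ∀ {x y} → Edges (factors m) x y → E x y
  to-F = ∈-resp-↭ σ

  from-F : ∀ {x y} → E x y → Edges (factors m) x y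
  from-F = ∈-resp-↭ (↭-sym σ)

  open Admissible (admissible-resp-↭ σ adm)

  i<j : i Fin.< j
  i<j = proj₁ (proj₂ (proj₂ (proj₁ lp)))

  j<k : j Fin.< k
  j<k = proj₂ (proj₂ (proj₂ (proj₁ lp)))

  i<k : i Fin.< k
  i<k = ℕ.<-trans i<j j<k

  j-≤-middle : ∀ {x y z} → E x y → E y z → j Fin.≤ y
  j-≤-middle e e' = proj₁ (proj₂ lp) _ _ _ (from-F e , from-F e' , increasing e , increasing e')

  i-≤-pred-j : ∀ {x} → E x j → i Fin.≤ x
  i-≤-pred-j e = proj₁ (proj₂ (proj₂ lp)) _ (from-F e)

  succ-j-≤-k : ∀ {z} → E j z → z Fin.≤ k
  succ-j-≤-k e = proj₂ (proj₂ (proj₂ lp)) _ (from-F e)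

  succ-j-<-k : ∀ {z} → E j z → z ≢ k → z Fin.< k
  succ-j-<-k e z≢k = ≤∧≢⇒< (succ-j-≤-k e) z≢k

  e-ij : E i j
  e-ij = here refl

  e-jk : E j k
  e-jk = there (here refl)

  no-middle-below-j : ∀ {u x y} → E u x → E x y → x Fin.< j → ⊥
  no-middle-below-j e e' x<j = ℕ.<⇒≱ x<j (j-≤-middle e e')

  no-edge-into-i : ∀ {u} → ¬ E u i
  no-edge-into-i e = no-middle-below-j e e-ij i<j

  star-into-j : ∀ {x} → Star E x j → x ≡ j ⊎ E x j
  star-into-j ε = inj₁ refl
  star-into-j (e ◅ r) with star-into-j r
  ... | inj₁ refl = inj₂ e
  ... | inj₂ e'   = ⊥-elim (no-middle-below-j e e' (increasing e'))

  star-into-pred-j : ∀ {a w} → Star E a w → E w j → a ≡ w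
  star-into-pred-j r e with star-trivial-or-snoc r
  ... | inj₁ a≡w           = a≡w
  ... | inj₂ (_ , _ , e')  = ⊥-elim (no-middle-below-j e' e (increasing e))

  star-into-i : ∀ {a} → Star E a i → a ≡ i
  star-into-i r with star-trivial-or-snoc r
  ... | inj₁ a≡i          = a≡i
  ... | inj₂ (_ , _ , e)  = ⊥-elim (no-edge-into-i e)

  ik∉F : ¬ E i k
  ik∉F e = <-irrefl refl (branchesOrdered e-ij e j<k (e-jk ◅ ε) ε)

  ij∉rest : ¬ (i , j) ∈L rest
  ij∉rest m with unique
  ... | (_ ∷ ij∉) ∷ _ = All.lookup ij∉ m refl

  jk∉rest : ¬ (j , k) ∈L rest
  jk∉rest m with unique
  ... | _ ∷ (jk∉ ∷ _) = All.lookup jk∉ m refl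

  ik∉rest : ¬ (i , k) ∈L rest
  ik∉rest = ik∉F ∘ there ∘ there

  unique₁ : Unique H₁
  unique₁ with unique
  ... | (_ ∷ ij∉) ∷ (_ ∷ unique-rest) =
    ((λ ik≡ij → <⇒≢ j<k (sym (cong proj₂ ik≡ij))) ∷ ¬Any⇒All¬ rest ik∉rest) ∷ (ij∉ ∷ unique-rest)

  unique₂ : Unique H₂
  unique₂ with unique
  ... | (_ ∷ ij∉) ∷ (jk∉ ∷ unique-rest) =
    ((λ jk≡ik → <⇒≢ i<j (sym (cong proj₁ jk≡ik))) ∷ jk∉) ∷ (¬Any⇒All¬ rest ik∉rest ∷ unique-rest)

  E₁-cases : ∀ {x y} → E₁ x y → (x , y) ≡ (i , k) ⊎ (E x y × (x , y) ≢ (j , k))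
  E₁-cases (here ≡ik)                = inj₁ ≡ik
  E₁-cases (there (here refl))       = inj₂ (e-ij , λ ij≡jk → <⇒≢ i<j (cong proj₁ ij≡jk))
  E₁-cases (there (there m))         = inj₂ (there (there m) , λ { refl → jk∉rest m })

  E₂-cases : ∀ {x y} → E₂ x y → (x , y) ≡ (i , k) ⊎ (E x y × (x , y) ≢ (i , j))
  E₂-cases (here refl)               = inj₂ (e-jk , λ jk≡ij → <⇒≢ i<j (sym (cong proj₁ jk≡ij)))
  E₂-cases (there (here ≡ik))        = inj₁ ≡ik
  E₂-cases (there (there m))         = inj₂ (there (there m) , λ { refl → ij∉rest m })

  E⇒E₁ : ∀ {x y} → E x y → (x , y) ≢ (j , k) → E₁ x y
  E⇒E₁ (here refl)         _    = there (here refl)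
  E⇒E₁ (there (here refl)) ≢jk  = ⊥-elim (≢jk refl)
  E⇒E₁ (there (there m))   _    = there (there m)

  E⇒E₂ : ∀ {x y} → E x y → (x , y) ≢ (i , j) → E₂ x y
  E⇒E₂ (here refl)         ≢ij  = ⊥-elim (≢ij refl)
  E⇒E₂ (there (here refl)) _    = here refl
  E⇒E₂ (there (there m))   _    = there (there m)

  module Child {H : List (Fin n × Fin n)} (cases : ∀ {x y} → Edges H x y → (x , y) ≡ (i , k) ⊎ E x y) where

    lift : ∀ {a b} → Star (Edges H) a b → Star E a b
    lift = edge-to-path ⋆
      where
      edge-to-path : ∀ {x y} → Edges H x y → Star E x y
      edge-to-path e with cases e
      ... | inj₁ refl = e-ij ◅ e-jk ◅ ε
      ... | inj₂ e'   = e' ◅ ε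

    branchesOrdered-child : (∀ {p q} → Edges H i j → Star (Edges H) j p → Star E k q → p Fin.< q) →
                            BranchesOrdered (Edges H)
    branchesOrdered-child via-j {x = x} e e' x<y r r' with cases e | cases e'
    ... | inj₂ f     | inj₂ f'    = branchesOrdered f f' x<y (lift r) (lift r')
    ... | inj₁ refl  | inj₁ refl  = ⊥-elim (<-irrefl refl x<y)
    ... | inj₁ refl  | inj₂ f'    = branchesOrdered e-ij f' (ℕ.<-trans j<k x<y) (e-jk ◅ lift r) (lift r')
    ... | inj₂ f     | inj₁ refl with <-cmp x j
    ...   | tri< x<j _ _  = branchesOrdered f e-ij x<j (lift r) (e-jk ◅ lift r')
    ...   | tri≈ _ refl _ = via-j e r (lift r')
    ...   | tri> _ _ j<x  = ⊥-elim (ℕ.<⇒≱ (branchesOrdered e-ij f j<x (e-jk ◅ ε) ε) (ℕ.<⇒≤ x<y))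

  open Child {H₁} (map₂ proj₁ ∘ E₁-cases)
    renaming (lift to lift₁; branchesOrdered-child to branchesOrdered₁-by)
  open Child {H₂} (map₂ proj₁ ∘ E₂-cases)
    renaming (lift to lift₂; branchesOrdered-child to branchesOrdered₂-by)

  star₁-from-j-<-star-from-k : ∀ {p q} → Star E₁ j p → Star E k q → p Fin.< q
  star₁-from-j-<-star-from-k ε r' = ℕ.<-≤-trans j<k (star-≤ increasing r')
  star₁-from-j-<-star-from-k (e ◅ r) r' with E₁-cases e
  ... | inj₁ jz≡ik = ⊥-elim (<⇒≢ i<j (sym (cong proj₁ jz≡ik)))
  ... | inj₂ (f , ≢jk) = branchesOrdered f e-jk (succ-j-<-k f (≢jk ∘ cong (j ,_))) (lift₁ r) r'

  branchesOrdered₁ : BranchesOrdered E₁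
  branchesOrdered₁ = branchesOrdered₁-by (λ _ → star₁-from-j-<-star-from-k)

  ij∉H₂ : ¬ E₂ i j
  ij∉H₂ e with E₂-cases e
  ... | inj₁ ij≡ik       = <⇒≢ j<k (cong proj₂ ij≡ik)
  ... | inj₂ (_ , ≢ij)   = ≢ij refl

  branchesOrdered₂ : BranchesOrdered E₂
  branchesOrdered₂ = branchesOrdered₂-by (λ e → ⊥-elim (ij∉H₂ e))

  star-above-j⇒star₁ : ∀ {x y} → j Fin.< x → Star E x y → Star E₁ x y
  star-above-j⇒star₁ j<x ε       = ε
  star-above-j⇒star₁ j<x (e ◅ r) =
    E⇒E₁ e (λ xz≡jk → <⇒≢ j<x (sym (cong proj₁ xz≡jk)))
      ◅ star-above-j⇒star₁ (ℕ.<-trans j<x (increasing e)) r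

  star-above-i⇒star₂ : ∀ {x y} → i Fin.< x → Star E x y → Star E₂ x y
  star-above-i⇒star₂ i<x ε       = ε
  star-above-i⇒star₂ i<x (e ◅ r) =
    E⇒E₂ e (λ xz≡ij → <⇒≢ i<x (sym (cong proj₁ xz≡ij)))
      ◅ star-above-i⇒star₂ (ℕ.<-trans i<x (increasing e)) r

  -- ThroughJK and ThroughIJ describe the F-paths that have no counterpart in H₁ and in H₂.

  EntersJ : Fin n → Set
  EntersJ x = x ≡ j ⊎ (E x j × x ≢ i)

  ThroughJK : Fin n → Fin n → Set
  ThroughJK x y = Star E₁ k y × EntersJ x

  AfterIJ : Fin n → Set
  AfterIJ y = y ≡ j ⊎ ∃ λ z → E j z × z ≢ k × Star E z y

  ThroughIJ : Fin n → Fin n → Set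
  ThroughIJ x y = x ≡ i × AfterIJ y

  star⇒star₁ : ∀ {x y} → Star E x y → Star E₁ x y ⊎ ThroughJK x y
  star⇒star₁ ε = inj₁ ε
  star⇒star₁ (_◅_ {x} {z} e r) with (x , z) ≟ₚ (j , k)
  ... | yes refl = inj₂ (star-above-j⇒star₁ j<k r , inj₁ refl)
  ... | no ≢jk with star⇒star₁ r
  ...   | inj₁ r₁                  = inj₁ (E⇒E₁ e ≢jk ◅ r₁)
  ...   | inj₂ (_ , inj₂ (f , _))  = ⊥-elim (no-middle-below-j e f (increasing f))
  ...   | inj₂ (r₁ , inj₁ refl) with x ≟ i
  ...     | yes refl = inj₁ (here refl ◅ r₁)
  ...     | no x≢i   = inj₂ (r₁ , inj₂ (e , x≢i))

  star-after-ij⇒star₂ : ∀ {y} → Star E j y → Star E₂ i y ⊎ ThroughIJ i y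
  star-after-ij⇒star₂ ε = inj₂ (refl , inj₁ refl)
  star-after-ij⇒star₂ (_◅_ {j = z} e r) with z ≟ k
  ... | yes refl = inj₁ (there (here refl) ◅ star-above-i⇒star₂ i<k r)
  ... | no z≢k   = inj₂ (refl , inj₂ (z , e , z≢k , r))

  star⇒star₂ : ∀ {x y} → Star E x y → Star E₂ x y ⊎ ThroughIJ x y
  star⇒star₂ ε = inj₁ ε
  star⇒star₂ (_◅_ {x} {z} e r) with (x , z) ≟ₚ (i , j)
  ... | yes refl = star-after-ij⇒star₂ r
  ... | no ≢ij with star⇒star₂ r
  ...   | inj₁ r₂         = inj₁ (E⇒E₂ e ≢ij ◅ r₂)
  ...   | inj₂ (refl , _) = ⊥-elim (no-edge-into-i e)

  i-≤-source-into-j : ∀ {a} → Star E a j → i Fin.≤ a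
  i-≤-source-into-j r with star-into-j r
  ... | inj₁ refl = ℕ.<⇒≤ i<j
  ... | inj₂ e    = i-≤-pred-j e

  star-into-j⇒star₁ : ∀ {x} → Star E x j → Star E₁ x j
  star-into-j⇒star₁ r with star-into-j r
  ... | inj₁ refl = ε
  ... | inj₂ e    = E⇒E₁ e (λ xj≡jk → <⇒≢ j<k (cong proj₂ xj≡jk)) ◅ ε

  star₁-not-through-jk : ∀ {a b} → Star E₁ a b → Star E k b → ¬ EntersJ a
  star₁-not-through-jk X r (inj₁ refl) = <-irrefl refl (star₁-from-j-<-star-from-k X r)
  star₁-not-through-jk ε r (inj₂ (f , _)) =
    ℕ.<⇒≱ (ℕ.<-trans (increasing f) j<k) (star-≤ increasing r)
  star₁-not-through-jk (e ◅ X) r (inj₂ (f , a≢i)) with E₁-cases e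
  ... | inj₁ az≡ik = a≢i (cong proj₁ az≡ik)
  ... | inj₂ (e' , _) with branches-meet⇒≡ branchesOrdered e' f (lift₁ X) (e-jk ◅ r)
  ...   | refl = <-irrefl refl (star₁-from-j-<-star-from-k X r)

  star₁-passes-through : ∀ {a b w} → Star E₁ a b → Star E a w → Star E w b → w ≢ j →
                         Star E₁ a w × Star E₁ w b
  star₁-passes-through X aw wb w≢j with star⇒star₁ aw | star⇒star₁ wb
  ... | inj₂ (kw , entry) | _                    = ⊥-elim (star₁-not-through-jk X (lift₁ kw ◅◅ wb) entry)
  ... | inj₁ aw₁ | inj₁ wb₁                      = aw₁ , wb₁
  ... | inj₁ _   | inj₂ (_ , inj₁ w≡j)           = ⊥-elim (w≢j w≡j)
  ... | inj₁ _   | inj₂ (_ , inj₂ (f , _)) with star-into-pred-j aw f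
  ...   | refl = ε , X

  through-jk-starts-at-i : ∀ {a b} → Star E₁ a b → Star E a j → Star E₁ k b → a ≡ i
  through-jk-starts-at-i {a} X aj kb with star-into-j aj
  ... | inj₁ refl = ⊥-elim (star₁-not-through-jk X (lift₁ kb) (inj₁ refl))
  ... | inj₂ f with a ≟ i
  ...   | yes a≡i = a≡i
  ...   | no a≢i  = ⊥-elim (star₁-not-through-jk X (lift₁ kb) (inj₂ (f , a≢i)))

  crossing₁-meet-at-j : ∀ {a b a' b'} → Star E₁ a' b' → a Fin.< a' → b Fin.< b' →
                        Star E a j → Star E j b → Star E a' j → Star E j b' →
                        ∃ λ w → Star E₁ a w × Star E₁ w b × Star E₁ a' w × Star E₁ w b'
  crossing₁-meet-at-j {a} Y a<a' b<b' aj jb a'j jb' with star⇒star₁ jb'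
  ... | inj₂ (kb' , _) =
    ⊥-elim (ℕ.<⇒≱ (subst (a Fin.<_) (through-jk-starts-at-i Y a'j kb') a<a') (i-≤-source-into-j aj))
  ... | inj₁ jb'₁ with star⇒star₁ jb
  ...   | inj₁ jb₁      = j , star-into-j⇒star₁ aj , jb₁ , star-into-j⇒star₁ a'j , jb'₁
  ...   | inj₂ (kb , _) = ⊥-elim (ℕ.<⇒≱ b<b' (ℕ.<⇒≤ (star₁-from-j-<-star-from-k jb'₁ (lift₁ kb))))

  crossingPathsMeet₁ : CrossingPathsMeet E₁
  crossingPathsMeet₁ X Y cross with crossingPathsMeet (lift₁ X) (lift₁ Y) cross
  ... | w , aw , wb , a'w , wb' with w ≟ j
  ...   | yes refl = crossing₁-meet-at-j Y (proj₁ cross) (proj₂ (proj₂ cross)) aw wb a'w wb'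
  ...   | no w≢j   =
    let (aw₁ , wb₁) = star₁-passes-through X aw wb w≢j
        (a'w₁ , wb'₁) = star₁-passes-through Y a'w wb' w≢j
    in w , aw₁ , wb₁ , a'w₁ , wb'₁

  star₂-from-i-not-after-ij : ∀ {b z} → Star E₂ i b → E j z → z ≢ k → ¬ Star E z b
  star₂-from-i-not-after-ij ε f z≢k zb = ℕ.<⇒≱ (ℕ.<-trans i<j (increasing f)) (star-≤ increasing zb)
  star₂-from-i-not-after-ij (e ◅ r) f z≢k zb with E₂-cases e
  ... | inj₁ refl       = z≢k (branches-meet⇒≡ branchesOrdered f e-jk zb (lift₂ r))
  ... | inj₂ (e' , ≢ij) = ≢ij (cong (i ,_) (branches-meet⇒≡ branchesOrdered e' e-ij (lift₂ r) (f ◅ zb)))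

  star₂-passes-through : ∀ {a b w} → Star E₂ a b → Star E a w → Star E w b → w ≢ j →
                         Star E₂ a w × Star E₂ w b
  star₂-passes-through X aw wb w≢j with star⇒star₂ aw
  ... | inj₂ (refl , inj₁ w≡j)                   = ⊥-elim (w≢j w≡j)
  ... | inj₂ (refl , inj₂ (z , f , z≢k , zw))    = ⊥-elim (star₂-from-i-not-after-ij X f z≢k (zw ◅◅ wb))
  ... | inj₁ aw₂ with star⇒star₂ wb
  ...   | inj₁ wb₂        = aw₂ , wb₂
  ...   | inj₂ (refl , _) with star-into-i aw
  ...     | refl = ε , X

  star₂-from-i-via-k : ∀ {b} → Star E₂ i b → Star E j b → Star E₂ k b
  star₂-from-i-via-k ε jb = ⊥-elim (ℕ.<⇒≱ i<j (star-≤ increasing jb))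
  star₂-from-i-via-k (e ◅ r) jb with E₂-cases e
  ... | inj₁ refl       = r
  ... | inj₂ (e' , ≢ij) = ⊥-elim (≢ij (cong (i ,_) (branches-meet⇒≡ branchesOrdered e' e-ij (lift₂ r) jb)))

  crossing₂-from-i-meet-at-k : ∀ {a' b b'} → Star E₂ k b → Star E₂ a' j → Star E j b' → b Fin.< b' →
                               ∃ λ w → Star E₂ i w × Star E₂ w b × Star E₂ a' w × Star E₂ w b'
  crossing₂-from-i-meet-at-k kb a'j ε b<j =
    ⊥-elim (<-irrefl refl (ℕ.<-trans (ℕ.<-≤-trans j<k (star-≤ increasing (lift₂ kb))) b<j))
  crossing₂-from-i-meet-at-k kb a'j (_◅_ {j = z} e r) b<b' with z ≟ k
  ... | yes refl = k , there (here refl) ◅ ε , kb , a'j ◅◅ (here refl ◅ ε) , star-above-i⇒star₂ i<k r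
  ... | no z≢k   =
    ⊥-elim (<-irrefl refl (ℕ.<-trans b<b' (branchesOrdered e e-jk (succ-j-<-k e z≢k) r (lift₂ kb))))

  crossing₂-meet-at-j : ∀ {a b a' b'} → Star E₂ a b → a Fin.< a' → b Fin.< b' →
                        Star E a j → Star E j b → Star E a' j → Star E j b' →
                        ∃ λ w → Star E₂ a w × Star E₂ w b × Star E₂ a' w × Star E₂ w b'
  crossing₂-meet-at-j X a<a' b<b' aj jb a'j jb' with star⇒star₂ a'j
  ... | inj₂ (refl , _) = ⊥-elim (ℕ.<⇒≱ a<a' (i-≤-source-into-j aj))
  ... | inj₁ a'j₂ with star⇒star₂ aj
  ...   | inj₁ aj₂        = j , aj₂ , star-above-i⇒star₂ i<j jb , a'j₂ , star-above-i⇒star₂ i<j jb'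
  ...   | inj₂ (refl , _) = crossing₂-from-i-meet-at-k (star₂-from-i-via-k X jb) a'j₂ jb' b<b'

  crossingPathsMeet₂ : CrossingPathsMeet E₂
  crossingPathsMeet₂ X Y cross with crossingPathsMeet (lift₂ X) (lift₂ Y) cross
  ... | w , aw , wb , a'w , wb' with w ≟ j
  ...   | yes refl = crossing₂-meet-at-j X (proj₁ cross) (proj₂ (proj₂ cross)) aw wb a'w wb'
  ...   | no w≢j   =
    let (aw₂ , wb₂) = star₂-passes-through X aw wb w≢j
        (a'w₂ , wb'₂) = star₂-passes-through Y a'w wb' w≢j
    in w , aw₂ , wb₂ , a'w₂ , wb'₂

  admissible₁ : Admissible H₁
  admissible₁ = record
    { unique = unique₁ ; increasing = increasing₁ ; branchesOrdered = branchesOrdered₁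
    ; crossingPathsMeet = crossingPathsMeet₁ }
    where
    increasing₁ : Increasing E₁
    increasing₁ e with E₁-cases e
    ... | inj₁ refl   = i<k
    ... | inj₂ (f , _) = increasing f

  admissible₂ : Admissible H₂
  admissible₂ = record
    { unique = unique₂ ; increasing = increasing₂ ; branchesOrdered = branchesOrdered₂
    ; crossingPathsMeet = crossingPathsMeet₂ }
    where
    increasing₂ : Increasing E₂
    increasing₂ e with E₂-cases e
    ... | inj₁ refl   = i<k
    ... | inj₂ (f , _) = increasing f

  through-ij-crosses-through-jk : ∀ {a b a' b'} → ThroughIJ a b → ThroughJK a' b' → Crossing (a , b) (a' , b')
  through-ij-crosses-through-jk {b = b} {a'} {b'} (refl , after) (kb' , entry) =
    i<a' entry , ℕ.≤-trans (a'≤j entry) (j≤b after) , b<b' after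
    where
    i<a' : EntersJ a' → i Fin.< a'
    i<a' (inj₁ refl)        = i<j
    i<a' (inj₂ (f , a'≢i))  = ≤∧≢⇒< (i-≤-pred-j f) (a'≢i ∘ sym)
    a'≤j : EntersJ a' → a' Fin.≤ j
    a'≤j (inj₁ refl)        = ℕ.≤-refl
    a'≤j (inj₂ (f , _))     = ℕ.<⇒≤ (increasing f)
    j≤b : AfterIJ b → j Fin.≤ b
    j≤b (inj₁ refl)               = ℕ.≤-refl
    j≤b (inj₂ (_ , f , _ , zb))   = ℕ.<⇒≤ (ℕ.<-≤-trans (increasing f) (star-≤ increasing zb))
    b<b' : AfterIJ b → b Fin.< b'
    b<b' (inj₁ refl)              = ℕ.<-≤-trans j<k (star-≤ increasing (lift₁ kb'))
    b<b' (inj₂ (_ , f , z≢k , zb)) = branchesOrdered f e-jk (succ-j-<-k f z≢k) zb (lift₁ kb')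

  noncrossing-split : ∀ {S} → NonCrossing S → All (Connects (Edges (factors m))) S →
                      All (Connects E₁) S ⊎ All (Connects E₂) S
  noncrossing-split {S} noncrossing routes = split (All.map (Star.map to-F) routes)
    where
    split : All (Connects E) S → All (Connects E₁) S ⊎ All (Connects E₂) S
    split routesF with all-or-witness star⇒star₁ routesF
    ... | inj₁ routes₁ = inj₁ routes₁
    ... | inj₂ (s' , s'∈S , through-jk) = inj₂ (All.tabulate (λ s∈S → to₂ s∈S (All.lookup routesF s∈S)))
      where
      to₂ : ∀ {s} → s ∈L S → Connects E s → Connects E₂ s
      to₂ s∈S r with star⇒star₂ r
      ... | inj₁ r₂         = r₂
      ... | inj₂ through-ij = ⊥-elim (noncrossing s∈S s'∈S (through-ij-crosses-through-jk through-ij through-jk))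

-- Leaves of a reduction in the length order

module _ {n : ℕ} where

  open Admissible

  reduced-star : ∀ {M : Mono n} → Increasing (Edges (factors M)) → IsReduced M → ∀ {a b} →
                 Star (Edges (factors M)) a b → Edges (factors M) a b ⊎ a ≡ b
  reduced-star inc reduced ε             = inj₂ refl
  reduced-star inc reduced (e ◅ ε)       = inj₁ e
  reduced-star inc reduced (e ◅ e' ◅ _)  = ⊥-elim (reduced _ _ _ (e , e' , inc e , inc e'))

  reduced-meeting-point : ∀ {M : Mono n} → Increasing (Edges (factors M)) → IsReduced M → ∀ {a w b} →
                          Star (Edges (factors M)) a w → Star (Edges (factors M)) w b → w ≡ b ⊎ a ≡ w
  reduced-meeting-point {M} inc reduced aw wb with reduced-star {M} inc reduced aw | reduced-star {M} inc reduced wb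
  ... | inj₁ e   | inj₁ e'  = ⊥-elim (reduced _ _ _ (e , e' , inc e , inc e'))
  ... | _        | inj₂ w≡b = inj₁ w≡b
  ... | inj₂ a≡w | _        = inj₂ a≡w

  -- Paths have at most one edge, so the meeting point of two crossing paths is an end of both.
  reduced-admissible-noncrossing : ∀ {M : Mono n} → Admissible (factors M) → IsReduced M → ∀ {s t} →
                                   Connects (Edges (factors M)) s → Connects (Edges (factors M)) t →
                                   ¬ Crossing s t
  reduced-admissible-noncrossing {M} adm reduced X Y cross@(a<a' , _ , b<b')
    with crossingPathsMeet adm X Y cross
  ... | w , aw , wb , a'w , wb' with reduced-meeting-point {M} (increasing adm) reduced aw wb
                                  | reduced-meeting-point {M} (increasing adm) reduced a'w wb'
  ...   | inj₂ refl | _         = ℕ.<⇒≱ a<a' (star-≤ (increasing adm) a'w)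
  ...   | _         | inj₁ refl = ℕ.<⇒≱ b<b' (star-≤ (increasing adm) wb)
  ...   | inj₁ refl | inj₂ refl with reduced-star {M} (increasing adm) reduced aw
                                | reduced-star {M} (increasing adm) reduced wb'
  ...     | inj₁ e    | inj₁ e'   = reduced _ _ _ (e , e' , increasing adm e , increasing adm e')
  ...     | inj₂ refl | _         = <-irrefl refl a<a'
  ...     | _         | inj₂ refl = <-irrefl refl (ℕ.<-≤-trans b<b' (star-≤ (increasing adm) a'w))

  ∈-children : ∀ {M : Mono n} p₁ p₂ {p₃} → M ∈L p₁ ++ p₂ ++ p₃ →
               M ∈L p₁ ⊎ M ∈L p₂ ⊎ M ∈L p₃
  ∈-children p₁ p₂ M∈ with ∈-++⁻ p₁ M∈
  ... | inj₁ M∈p₁ = inj₁ M∈p₁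
  ... | inj₂ M∈p  = inj₂ (∈-++⁻ p₂ M∈p)

  βdeg-≤-leaf : ∀ {m : Mono n} {p} → Reduces m p → ∀ {M} → M ∈L p → βdeg m ℕ.≤ βdeg M
  βdeg-≤-leaf (done _) (here refl) = ℕ.≤-refl
  βdeg-≤-leaf (step {p₁ = p₁} {p₂} _ _ r₁ r₂ r₃) M∈ with ∈-children p₁ p₂ M∈
  ... | inj₁ M∈p₁        = βdeg-≤-leaf r₁ M∈p₁
  ... | inj₂ (inj₁ M∈p₂) = βdeg-≤-leaf r₂ M∈p₂
  ... | inj₂ (inj₂ M∈p₃) = ℕ.<⇒≤ (βdeg-≤-leaf r₃ M∈p₃)

  leaf-admissible : ∀ {m : Mono n} {p} → Reduces m p → Admissible (factors m) →
                    ∀ {M} → M ∈L p → βdeg M ≡ βdeg m → Admissible (factors M) × IsReduced M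
  leaf-admissible (done reduced) adm (here refl) _ = adm , reduced
  leaf-admissible {m} (step {p₁ = p₁} {p₂} lp σ r₁ r₂ r₃) adm M∈ β≡ with ∈-children p₁ p₂ M∈
  ... | inj₁ M∈p₁        = leaf-admissible r₁ (LengthStep.admissible₁ {m = m} adm lp σ) M∈p₁ β≡
  ... | inj₂ (inj₁ M∈p₂) = leaf-admissible r₂ (LengthStep.admissible₂ {m = m} adm lp σ) M∈p₂ β≡
  ... | inj₂ (inj₂ M∈p₃) = ⊥-elim (ℕ.<-irrefl (sym β≡) (βdeg-≤-leaf r₃ M∈p₃))

  noncrossing-reaches-leaf : ∀ {m : Mono n} {p} → Reduces m p → Admissible (factors m) →
                             ∀ {S} → NonCrossing S → All (Connects (Edges (factors m))) S →
                             ∃ λ M → M ∈L p × βdeg M ≡ βdeg m ×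
                                     All (λ s → s ∈L factors M ⊎ proj₁ s ≡ proj₂ s) S
  noncrossing-reaches-leaf {m} (done reduced) adm _ routes =
    m , here refl , refl , All.map (reduced-star {m} (increasing adm) reduced) routes
  noncrossing-reaches-leaf {m} (step {p₁ = p₁} lp σ r₁ r₂ _) adm noncrossing routes
    with LengthStep.noncrossing-split {m = m} adm lp σ noncrossing routes
  ... | inj₁ routes₁ =
    let (M , M∈ , β≡ , spanned) =
          noncrossing-reaches-leaf r₁ (LengthStep.admissible₁ {m = m} adm lp σ) noncrossing routes₁
    in M , ∈-++⁺ˡ M∈ , β≡ , spanned
  ... | inj₂ routes₂ =
    let (M , M∈ , β≡ , spanned) =
          noncrossing-reaches-leaf r₂ (LengthStep.admissible₂ {m = m} adm lp σ) noncrossing routes₂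
    in M , ∈-++⁺ʳ p₁ (∈-++⁺ˡ M∈) , β≡ , spanned

module _ {n : ℕ} where

  open DecMembership (_≟ₚ_ {n}) using (_∈?_)

  weight : Fin n × Fin n → ℕ
  weight (a , b) = toℕ a ℕ.+ (n ℕ.∸ toℕ b)

  size : List (Fin n × Fin n) → ℕ
  size F = sum (map weight F)

  size-resp-↭ : ∀ {F F'} → F ↭ F' → size F ≡ size F'
  size-resp-↭ σ = sum-↭ (map⁺ weight σ)

  size-children : ∀ {i j k} rest → i Fin.< j → j Fin.< k →
                  let s = size ((i , j) ∷ (j , k) ∷ rest) in
                  size ((i , k) ∷ (i , j) ∷ rest) ℕ.< s × size ((j , k) ∷ (i , k) ∷ rest) ℕ.< s ×
                  size ((i , k) ∷ rest) ℕ.< s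
  size-children {i} {j} {k} rest i<j j<k =
    subst (ℕ._< A ℕ.+ (B ℕ.+ R)) (size-resp-↭ (swap (i , j) (i , k) (↭-refl {x = rest})))
      (ℕ.+-monoʳ-< A (ℕ.+-monoˡ-< R C<B)) ,
    subst (ℕ._< A ℕ.+ (B ℕ.+ R)) (size-resp-↭ (swap (i , k) (j , k) (↭-refl {x = rest})))
      (ℕ.+-monoˡ-< (B ℕ.+ R) C<A) ,
    ℕ.≤-<-trans (ℕ.+-monoʳ-≤ C (ℕ.m≤n+m R B)) (ℕ.+-monoˡ-< (B ℕ.+ R) C<A)
    where
    A B C R : ℕ
    A = weight (i , j)
    B = weight (j , k)
    C = weight (i , k)
    R = size rest
    C<B : C ℕ.< B
    C<B = ℕ.+-monoˡ-< (n ℕ.∸ toℕ k) i<j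
    C<A : C ℕ.< A
    C<A = ℕ.+-monoʳ-< (toℕ i) (ℕ.∸-monoʳ-< j<k (toℕ≤n k))

  select : ∀ {x : Fin n × Fin n} {xs} → x ∈L xs → ∃ λ rest → xs ↭ x ∷ rest
  select x∈xs with ∈-∃++ x∈xs
  ... | ys , zs , refl = ys ++ zs , shift _ ys zs

  HasPair? : ∀ (m : Mono n) i j k → Dec (HasPair m i j k)
  HasPair? m i j k = ((i , j) ∈? factors m) ×-dec ((j , k) ∈? factors m) ×-dec (i <? j) ×-dec (j <? k)

  length-pair : ∀ {m : Mono n} → (∃ λ i → ∃ λ j → ∃ λ k → HasPair m i j k) →
                ∃ λ i → ∃ λ j → ∃ λ k → LengthPair m i j k
  length-pair {m} (i₀ , j₀ , k₀ , pair₀) =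
    i , j , k ,
    (ij∈ , jk∈ , ℕ.≤-<-trans (i-least i₁ i₁j∈) i₁<j , ℕ.<-≤-trans j<k₁ (k-greatest k₁ jk₁∈)) ,
    (λ i' j' k' pair → j-least j' (i' , k' , pair)) , i-least , k-greatest
    where
    middle = least (λ j → any? (λ i → any? (λ k → HasPair? m i j k))) (j₀ , i₀ , k₀ , pair₀)
    j = proj₁ middle
    j-least = proj₂ (proj₂ middle)
    i₁ = proj₁ (proj₁ (proj₂ middle))
    k₁ = proj₁ (proj₂ (proj₁ (proj₂ middle)))
    pair₁ : HasPair m i₁ j k₁
    pair₁ = proj₂ (proj₂ (proj₁ (proj₂ middle)))
    i₁j∈ = proj₁ pair₁
    jk₁∈ = proj₁ (proj₂ pair₁)
    i₁<j = proj₁ (proj₂ (proj₂ pair₁))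
    j<k₁ = proj₂ (proj₂ (proj₂ pair₁))
    source = least (λ i → (i , j) ∈? factors m) (i₁ , i₁j∈)
    i = proj₁ source
    ij∈ = proj₁ (proj₂ source)
    i-least = proj₂ (proj₂ source)
    target = greatest (λ k → (j , k) ∈? factors m) (k₁ , jk₁∈)
    k = proj₁ target
    jk∈ = proj₁ (proj₂ target)
    k-greatest = proj₂ (proj₂ target)

  length-pair-front : ∀ {m : Mono n} {i j k} → LengthPair m i j k →
                      ∃ λ rest → factors m ↭ (i , j) ∷ (j , k) ∷ rest
  length-pair-front ((ij∈ , jk∈ , i<j , _) , _) with select ij∈
  ... | rest₁ , σ₁ with ∈-resp-↭ σ₁ jk∈
  ...   | here jk≡ij  = ⊥-elim (<⇒≢ i<j (sym (cong proj₁ jk≡ij)))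
  ...   | there jk∈′ with select jk∈′
  ...     | rest , σ₂ = rest , ↭-trans σ₁ (prep _ σ₂)

  reduces-exists : (m : Mono n) → ∃ (Reduces m)
  reduces-exists m = go m (<-wellFounded (size (factors m)))
    where
    go : (m : Mono n) → Acc ℕ._<_ (size (factors m)) → ∃ (Reduces m)
    go m (acc smaller) with any? (λ i → any? (λ j → any? (λ k → HasPair? m i j k)))
    ... | no none = _ , done (λ i j k pair → none (i , j , k , pair))
    ... | yes pair with length-pair {m} pair
    ...   | i , j , k , lp@((_ , _ , i<j , j<k) , _) with length-pair-front {m} lp
    ...     | rest , σ with size-children rest i<j j<k
    ...       | s₁ , s₂ , s₃ =
      _ , step lp σ (proj₂ (go _ (smaller (shrink s₁)))) (proj₂ (go _ (smaller (shrink s₂))))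
                    (proj₂ (go _ (smaller (shrink s₃))))
      where
      shrink : ∀ {s} → s ℕ.< size ((i , j) ∷ (j , k) ∷ rest) → s ℕ.< size (factors m)
      shrink s< = subst (_ ℕ.<_) (sym (size-resp-↭ σ)) s<

-- The graph G(I, J̄), its routes and its faces

module PrecGraph {n : ℕ} (I J : Subset n) where

  Between? : ∀ i j → Dec (Between I J i j)
  Between? i j = any? (λ x → x ∈S? I ×-dec i <? x ×-dec x ≤? j)
           ⊎-dec any? (λ x → x ∈S? J ×-dec i ≤? x ×-dec x <? j)

  ImmPred? : ∀ i j → Dec (ImmPred I J i j)
  ImmPred? i j = i ∈S? I ×-dec i ≤? j ×-dec ¬? (Between? i j)

  IsPrec? : ∀ j v → Dec (IsPrec I J j v)
  IsPrec? j v = ImmPred? v j ⊎-dec (all? (λ i → ¬? (ImmPred? i j)) ×-dec v ≟ j)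

  InPrecJ? : ∀ v → Dec (InPrecJ I J v)
  InPrecJ? v = any? (λ j → j ∈S? J ×-dec IsPrec? j v)

  prec-exists : ∀ j → ∃ (IsPrec I J j)
  prec-exists j with any? (λ i → ImmPred? i j)
  ... | yes (i , imm) = i , inj₁ imm
  ... | no none       = j , inj₂ ((λ i imm → none (i , imm)) , refl)

  prec-≤ : ∀ {j b} → IsPrec I J j b → b Fin.≤ j
  prec-≤ (inj₁ (_ , b≤j , _)) = b≤j
  prec-≤ (inj₂ (_ , refl))    = ℕ.≤-refl

  prec-functional : ∀ {j b b'} → IsPrec I J j b → IsPrec I J j b' → b ≡ b'
  prec-functional {b = b} {b'} (inj₁ (b∈I , b≤j , free)) (inj₁ (b'∈I , b'≤j , free')) with <-cmp b b'
  ... | tri< b<b' _ _ = ⊥-elim (free (inj₁ (b' , b'∈I , b<b' , b'≤j)))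
  ... | tri≈ _ b≡b' _ = b≡b'
  ... | tri> _ _ b'<b = ⊥-elim (free' (inj₁ (b , b∈I , b'<b , b≤j)))
  prec-functional (inj₁ imm)       (inj₂ (none , _))  = ⊥-elim (none _ imm)
  prec-functional (inj₂ (none , _)) (inj₁ imm)        = ⊥-elim (none _ imm)
  prec-functional (inj₂ (_ , b≡j)) (inj₂ (_ , b'≡j))  = trans b≡j (sym b'≡j)

  prec-strictMono : ∀ {j j' b b'} → j ∈S J → IsPrec I J j b → IsPrec I J j' b' → j Fin.< j' → b Fin.< b'
  prec-strictMono j∈J prec (inj₂ (_ , refl)) j<j' = ℕ.≤-<-trans (prec-≤ prec) j<j'
  prec-strictMono {j} {b' = b'} j∈J prec (inj₁ (_ , _ , free')) j<j' with b' ≤? j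
  ... | yes b'≤j = ⊥-elim (free' (inj₂ (j , j∈J , b'≤j , j<j')))
  ... | no b'≰j  = ℕ.≤-<-trans (prec-≤ prec) (ℕ.≰⇒> b'≰j)

  prec-injective : ∀ {j j' b} → j ∈S J → j' ∈S J → IsPrec I J j b → IsPrec I J j' b → j ≡ j'
  prec-injective {j} {j'} j∈J j'∈J prec prec' with <-cmp j j'
  ... | tri< j<j' _ _ = ⊥-elim (<-irrefl refl (prec-strictMono j∈J prec prec' j<j'))
  ... | tri≈ _ j≡j' _ = j≡j'
  ... | tri> _ _ j'<j = ⊥-elim (<-irrefl refl (prec-strictMono j'∈J prec' prec j'<j))

  I-≤-prec : ∀ {x j b} → x ∈S I → IsPrec I J j b → x Fin.≤ j → x Fin.≤ b
  I-≤-prec x∈I (inj₂ (_ , refl)) x≤j = x≤j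
  I-≤-prec {x} {b = b} x∈I (inj₁ (_ , _ , free)) x≤j with x ≤? b
  ... | yes x≤b = x≤b
  ... | no x≰b  = ⊥-elim (free (inj₁ (x , x∈I , ℕ.≰⇒> x≰b , x≤j)))

  Junction : Fin n → Set
  Junction v = v ∈S I × InPrecJ I J v

  Junction? : ∀ v → Dec (Junction v)
  Junction? v = v ∈S? I ×-dec InPrecJ? v

  NoJunctionBetween : Fin n → Fin n → Set
  NoJunctionBetween a b = ∀ c → Junction c → a Fin.< c → c Fin.< b → ⊥

  G : Fin n → Fin n → Set
  G = GEdge I J

  precEdge⁺ : ∀ {a b} → a ∈S I → InPrecJ I J b → a Fin.< b → PrecEdge I J a b
  precEdge⁺ a∈I (j , j∈J , prec) a<b =
    j , (a∈I , j∈J , ℕ.<⇒≤ (ℕ.<-≤-trans a<b (prec-≤ prec))) , prec , a<b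

  precEdge⁻ : ∀ {a b} → PrecEdge I J a b → a ∈S I × InPrecJ I J b × a Fin.< b
  precEdge⁻ (j , (a∈I , j∈J , _) , prec , a<b) = a∈I , (j , j∈J , prec) , a<b

  precPath⁻ : ∀ {c b} → TransClosure (PrecEdge I J) c b → c ∈S I × c Fin.< b
  precPath⁻ [ e ]   = let (a∈I , _ , a<b) = precEdge⁻ e in a∈I , a<b
  precPath⁻ (e ∷ r) = let (a∈I , _ , a<c) = precEdge⁻ e in a∈I , ℕ.<-trans a<c (proj₂ (precPath⁻ r))

  gEdge⁻ : ∀ {a b} → G a b → a ∈S I × InPrecJ I J b × a Fin.< b × NoJunctionBetween a b
  gEdge⁻ (e , not-shortcut) =
    let (a∈I , b∈ , a<b) = precEdge⁻ e
    in a∈I , b∈ , a<b ,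
       λ c (c∈I , c∈) a<c c<b → not-shortcut (c , precEdge⁺ a∈I c∈ a<c , [ precEdge⁺ c∈I b∈ c<b ])

  gEdge⁺ : ∀ {a b} → a ∈S I → InPrecJ I J b → a Fin.< b → NoJunctionBetween a b → G a b
  gEdge⁺ a∈I b∈ a<b none = precEdge⁺ a∈I b∈ a<b , λ (c , e , r) →
    let (c∈I , c<b) = precPath⁻ r ; (_ , c∈ , a<c) = precEdge⁻ e in none c (c∈I , c∈) a<c c<b

  G-increasing : Increasing G
  G-increasing e = proj₁ (proj₂ (proj₂ (gEdge⁻ e)))

  G-star⁻ : ∀ {x y} → Star G x y → x ≡ y ⊎ (x ∈S I × InPrecJ I J y)
  G-star⁻ ε       = inj₁ refl
  G-star⁻ (e ◅ r) with G-star⁻ r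
  ... | inj₁ refl         = inj₂ (proj₁ (gEdge⁻ e) , proj₁ (proj₂ (gEdge⁻ e)))
  ... | inj₂ (_ , y∈)     = inj₂ (proj₁ (gEdge⁻ e) , y∈)

  G-star-through-junction : ∀ {x y c} → Star G x y → Junction c → x Fin.≤ c → c Fin.≤ y →
                            Star G x c × Star G c y
  G-star-through-junction ε junction x≤c c≤x with ≤-antisym x≤c c≤x
  ... | refl = ε , ε
  G-star-through-junction {x} {c = c} (_◅_ {j = z} e r) junction x≤c c≤y with x ≟ c
  ... | yes refl = ε , e ◅ r
  ... | no x≢c with c <? z
  ...   | yes c<z = let (_ , _ , _ , none) = gEdge⁻ e in ⊥-elim (none c junction (≤∧≢⇒< x≤c x≢c) c<z)
  ...   | no c≮z  = let (zc , cy) = G-star-through-junction r junction (ℕ.≮⇒≥ c≮z) c≤y in e ◅ zc , cy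

  -- ℓ is the last element of I in [x, b] and j̄' the first element of J̄ after ℓ, so ℓ = prec(j̄').
  junction-between : ∀ {x b} → x ∈S I → InPrecJ I J b → x Fin.≤ b →
                     ∃ λ ℓ → Junction ℓ × x Fin.≤ ℓ × ℓ Fin.≤ b
  junction-between {x} {b} x∈I (j , j∈J , prec-j) x≤b =
    ℓ , (ℓ∈I , j' , j'∈J , inj₁ (ℓ∈I , ℓ≤j' , not-between)) , x≤ℓ , ℓ≤b
    where
    top = greatest (λ y → y ∈S? I ×-dec x ≤? y ×-dec y ≤? b) (x , x∈I , ℕ.≤-refl , x≤b)
    ℓ = proj₁ top
    ℓ∈I = proj₁ (proj₁ (proj₂ top))
    x≤ℓ = proj₁ (proj₂ (proj₁ (proj₂ top)))
    ℓ≤b = proj₂ (proj₂ (proj₁ (proj₂ top)))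
    ℓ-greatest = proj₂ (proj₂ top)
    ℓ≤j : ℓ Fin.≤ j
    ℓ≤j = ℕ.≤-trans ℓ≤b (prec-≤ prec-j)
    bottom = least (λ y → y ∈S? J ×-dec ℓ ≤? y) (j , j∈J , ℓ≤j)
    j' = proj₁ bottom
    j'∈J = proj₁ (proj₁ (proj₂ bottom))
    ℓ≤j' = proj₂ (proj₁ (proj₂ bottom))
    j'-least = proj₂ (proj₂ bottom)
    not-between : ¬ Between I J ℓ j'
    not-between (inj₁ (y , y∈I , ℓ<y , y≤j')) =
      ℕ.<⇒≱ ℓ<y (ℓ-greatest y (y∈I , ℕ.≤-trans x≤ℓ (ℕ.<⇒≤ ℓ<y) , y≤b))
      where
      y≤b = I-≤-prec y∈I prec-j (ℕ.≤-trans y≤j' (j'-least j (j∈J , ℓ≤j)))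
    not-between (inj₂ (y , y∈J , ℓ≤y , y<j')) = ℕ.<⇒≱ y<j' (j'-least y (y∈J , ℓ≤y))

  -- The lower out-neighbour x would be a junction inside the edge to the upper one unless x ∉ I,
  -- and then x is a sink.
  G-branchesOrdered : BranchesOrdered G
  G-branchesOrdered {x = x} e e' x<y r r' with x ∈S? I
  ... | yes x∈I =
    let (_ , x∈ , v<x , _) = gEdge⁻ e ; (_ , _ , _ , none) = gEdge⁻ e' in ⊥-elim (none x (x∈I , x∈) v<x x<y)
  ... | no x∉I with G-star⁻ r
  ...   | inj₁ refl       = ℕ.<-≤-trans x<y (star-≤ G-increasing r')
  ...   | inj₂ (x∈I , _)  = ⊥-elim (x∉I x∈I)

  G-crossingPathsMeet : CrossingPathsMeet G
  G-crossingPathsMeet X Y (a<a' , a'≤b , b<b') with G-star⁻ X | G-star⁻ Y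
  ... | inj₁ refl | _ = ⊥-elim (ℕ.<⇒≱ a<a' a'≤b)
  ... | _ | inj₁ refl = ⊥-elim (ℕ.<⇒≱ b<b' a'≤b)
  ... | inj₂ (_ , b∈) | inj₂ (a'∈I , _) =
    let (ℓ , junction , a'≤ℓ , ℓ≤b) = junction-between a'∈I b∈ a'≤b
        (aℓ , ℓb) = G-star-through-junction X junction (ℕ.<⇒≤ (ℕ.<-≤-trans a<a' a'≤ℓ)) ℓ≤b
        (a'ℓ , ℓb') = G-star-through-junction Y junction a'≤ℓ (ℕ.<⇒≤ (ℕ.≤-<-trans ℓ≤b b<b'))
    in ℓ , aℓ , ℓb , a'ℓ , ℓb'

  G-star : ∀ {a b} → a ∈S I → InPrecJ I J b → a Fin.≤ b → Star G a b
  G-star {a} a∈I b∈ a≤b = go _ b∈ a≤b (Fin.<-wellFounded _)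
    where
    go : ∀ b → InPrecJ I J b → a Fin.≤ b → Acc Fin._<_ b → Star G a b
    go b b∈ a≤b (acc below) with a ≟ b
    ... | yes refl = ε
    ... | no a≢b with any? (λ c → Junction? c ×-dec a <? c ×-dec c <? b)
    ...   | no none =
      gEdge⁺ a∈I b∈ (≤∧≢⇒< a≤b a≢b) (λ c junction a<c c<b → none (c , junction , a<c , c<b)) ◅ ε
    ...   | yes some with greatest (λ c → Junction? c ×-dec a <? c ×-dec c <? b) some
    ...     | c , ((c∈I , c∈) , a<c , c<b) , c-greatest =
      go c c∈ (ℕ.<⇒≤ a<c) (below c<b) ◅◅ gEdge⁺ c∈I b∈ c<b c-last ◅ ε
      where
      c-last : NoJunctionBetween c b
      c-last d junction c<d d<b = ℕ.<⇒≱ c<d (c-greatest d (junction , ℕ.<-trans a<c c<d , d<b))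

  route-arc-bijection : RouteArcBijection I J
  route-arc-bijection = route⇒arc , arc⇒route
    where
    route⇒arc : ∀ vs → IsRoute I J vs → ∃! _≡_ (λ s → Arc I J s × Corr I J vs s)
    route⇒arc vs (a , b , p , a∈I , j , j∈J , prec) =
      (a , j) , ((a∈I , j∈J , ℕ.≤-trans (star-≤ G-increasing (path⇒star p)) (prec-≤ prec)) , b , p , prec) ,
      λ { ((_ , j'∈J , _) , _ , p' , prec') → unique p' prec' j'∈J }
      where
      unique : ∀ {a' j' b'} → IsPath G vs a' b' → IsPrec I J j' b' → j' ∈S J → (a , j) ≡ (a' , j')
      unique p' prec' j'∈J with path-endpoints p p'
      ... | refl , refl with prec-injective j∈J j'∈J prec prec'
      ...   | refl = refl
    arc⇒route : ∀ s → Arc I J s → ∃! _≡_ (λ vs → IsRoute I J vs × Corr I J vs s)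
    arc⇒route (i , j) (i∈I , j∈J , i≤j) with prec-exists j
    ... | b , prec with star⇒path (G-star i∈I (j , j∈J , prec) (I-≤-prec i∈I prec i≤j))
    ...   | vs , p =
      vs , ((i , b , p , i∈I , j , j∈J , prec) , b , p , prec) , λ { (_ , b' , p' , prec') → unique p' prec' }
      where
      unique : ∀ {vs' b'} → IsPath G vs' i b' → IsPrec I J j b' → vs ≡ vs'
      unique p' prec' with prec-functional prec prec'
      ... | refl = path-unique G-increasing G-branchesOrdered p p'

  Enumerates : List (Fin n × Fin n) → Set
  Enumerates es = ∀ a b → ((a , b) ∈L es → G a b) × (G a b → (a , b) ∈L es)

  G-admissible : ∀ {es} → Unique es → Enumerates es → Admissible es
  G-admissible {es} es-unique es-edges = record
    { unique            = es-unique
    ; increasing        = G-increasing ∘ to-G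
    ; branchesOrdered   = λ e e' x<y r r' →
        G-branchesOrdered (to-G e) (to-G e') x<y (Star.map to-G r) (Star.map to-G r')
    ; crossingPathsMeet = λ r r' cross →
        let (w , aw , wb , a'w , wb') = G-crossingPathsMeet (Star.map to-G r) (Star.map to-G r') cross
        in w , Star.map from-G aw , Star.map from-G wb , Star.map from-G a'w , Star.map from-G wb'
    }
    where
    to-G : ∀ {x y} → Edges es x y → G x y
    to-G = proj₁ (es-edges _ _)
    from-G : ∀ {x y} → G x y → Edges es x y
    from-G = proj₂ (es-edges _ _)

  cross⇒crossing : ∀ {i j i' j' b b'} → Arc I J (i , j) → Arc I J (i' , j') →
                   IsPrec I J j b → IsPrec I J j' b' →
                   Cross I J (i , j) (i' , j') → Crossing (i , b) (i' , b')
  cross⇒crossing (_ , j∈J , _) (i'∈I , _ , _) prec prec' (i<i' , i'≤j , j<j') =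
    i<i' , I-≤-prec i'∈I prec i'≤j , prec-strictMono j∈J prec prec' j<j'

  crossing⇒cross : ∀ {i j i' j' b b'} → Arc I J (i , j) → Arc I J (i' , j') →
                   IsPrec I J j b → IsPrec I J j' b' →
                   Crossing (i , b) (i' , b') → Cross I J (i , j) (i' , j')
  crossing⇒cross {j = j} {j' = j'} (_ , j∈J , _) (_ , j'∈J , _) prec prec' (i<i' , i'≤b , b<b') =
    i<i' , ℕ.≤-trans i'≤b (prec-≤ prec) , j<j'
    where
    j<j' : j Fin.< j'
    j<j' with <-cmp j j'
    ... | tri< j<j' _ _ = j<j'
    ... | tri≈ _ refl _ = ⊥-elim (<⇒≢ b<b' (prec-functional prec prec'))
    ... | tri> _ _ j'<j = ⊥-elim (<-irrefl refl (ℕ.<-trans b<b' (prec-strictMono j'∈J prec' prec j'<j)))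

  in-Δ⇒star : ∀ {M vs x y} → InΔ I J M vs → IsPath G vs x y → Star (Edges (factors M)) x y
  in-Δ⇒star (inj₁ (_ , _ , ab∈ , p')) p with path-endpoints p' p
  ... | refl , refl = ab∈ ◅ ε
  in-Δ⇒star (inj₂ (_ , refl , _)) single = ε

  simplex⇒forest : ∀ {M} → Admissible (factors M) → IsReduced M → ∀ {Rs As} →
                   All (Arc I J) As → Pointwise (Corr I J) Rs As → All (InΔ I J M) Rs → Forest I J As
  simplex⇒forest {M} adm reduced arcs corr in-Δ s t s∈As t∈As cross
    with pointwise-∈ʳ corr s∈As | pointwise-∈ʳ corr t∈As
  ... | vs , vs∈Rs , _ , p , prec | vs' , vs'∈Rs , _ , p' , prec' =
    reduced-admissible-noncrossing {M = M} adm reduced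
      (in-Δ⇒star {M} (All.lookup in-Δ vs∈Rs) p) (in-Δ⇒star {M} (All.lookup in-Δ vs'∈Rs) p')
      (cross⇒crossing (All.lookup arcs s∈As) (All.lookup arcs t∈As) prec prec' cross)

  RouteEnds : List (Fin n) → Fin n × Fin n → Set
  RouteEnds vs (a , b) = IsPath G vs a b × a ∈S I × InPrecJ I J b

  route-endpoints : ∀ {Rs} → All (IsRoute I J) Rs → ∃ λ Ps → Pointwise RouteEnds Rs Ps
  route-endpoints []                                = [] , []
  route-endpoints ((a , b , p , a∈I , b∈) ∷ routes) =
    let (Ps , ends) = route-endpoints routes in (a , b) ∷ Ps , (p , a∈I , b∈) ∷ ends

  forest⇒simplex : ∀ {es p} → Admissible es → Enumerates es → Reduces (mono 0 es) p → ∀ {Rs As} →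
                   All (IsRoute I J) Rs → All (Arc I J) As → Pointwise (Corr I J) Rs As → Forest I J As →
                   ∃ λ M → M ∈L p × βdeg M ≡ 0 × All (InΔ I J M) Rs
  forest⇒simplex {es} adm es-edges r {Rs} routes arcs corr forest =
    let (Ps , ends) = route-endpoints routes
        (M , M∈p , β≡0 , spanned) = noncrossing-reaches-leaf r adm (noncrossing ends) (connects ends)
    in M , M∈p , β≡0 , in-Δ {M} ends spanned
    where
    connects : ∀ {Rs Ps} → Pointwise RouteEnds Rs Ps → All (Connects (Edges es)) Ps
    connects []               = []
    connects ((p , _) ∷ ends) = Star.map (proj₂ (es-edges _ _)) (path⇒star p) ∷ connects ends

    noncrossing : ∀ {Ps} → Pointwise RouteEnds Rs Ps → NonCrossing Ps
    noncrossing ends {s = x , y} {t = x' , y'} s∈Ps t∈Ps crossing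
      with pointwise-∈ʳ ends s∈Ps | pointwise-∈ʳ ends t∈Ps
    ... | vs , vs∈Rs , p , _ | vs' , vs'∈Rs , p' , _
      with pointwise-∈ˡ corr vs∈Rs | pointwise-∈ˡ corr vs'∈Rs
    ... | a , a∈As , _ , q , prec | a' , a'∈As , _ , q' , prec'
      with path-endpoints p q | path-endpoints p' q'
    ... | refl , refl | refl , refl =
      forest _ _ a∈As a'∈As (crossing⇒cross (All.lookup arcs a∈As) (All.lookup arcs a'∈As) prec prec' crossing)

    in-Δ : ∀ {M Rs Ps} → Pointwise RouteEnds Rs Ps →
           All (λ s → s ∈L factors M ⊎ proj₁ s ≡ proj₂ s) Ps → All (InΔ I J M) Rs
    in-Δ []                          []                    = []
    in-Δ {M} ((p , _) ∷ ends)        (inj₁ ab∈ ∷ spanned)  = inj₁ (_ , _ , ab∈ , p) ∷ in-Δ {M} ends spanned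
    in-Δ {M} ((p , a∈I , b∈) ∷ ends) (inj₂ refl ∷ spanned) =
      inj₂ (_ , path-trivial G-increasing p , a∈I , b∈) ∷ in-Δ {M} ends spanned

  faces-correspond : ∀ {es} → Unique es → Enumerates es → ∀ p → Reduces (mono 0 es) p → FacesCorrespond I J p
  faces-correspond es-unique es-edges p r Rs As routes arcs corr =
    (λ (M , M∈p , β≡0 , in-Δ) →
      let (adm-M , reduced) = leaf-admissible r adm M∈p β≡0 in simplex⇒forest {M} adm-M reduced arcs corr in-Δ) ,
    forest⇒simplex adm es-edges r routes arcs corr
    where
    adm = G-admissible es-unique es-edges

theorem4p6 : (n : ℕ) (I J : Subset n) → Valid I J →
    (es : List (Fin n × Fin n)) → Unique es →
    (∀ a b → ((a , b) ∈L es → GEdge I J a b) × (GEdge I J a b → (a , b) ∈L es)) →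
    RouteArcBijection I J
    × (∃ λ p → Reduces (mono 0 es) p)
    × (∀ p → Reduces (mono 0 es) p → FacesCorrespond I J p)
theorem4p6 n I J _ es es-unique es-edges =
  route-arc-bijection , reduces-exists (mono 0 es) , faces-correspond es-unique es-edges
  where
  open PrecGraph I J
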